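{- Let $k\in\mathbb{N}$ and let $G$ be a graph. If there exist vertices $u,v\in V(G)$ such that $$|\partial N_k(u)\setminus \partial N_k(v)| = 1 = |\partial N_k(v)\setminus \partial N_k(u)|,$$ then $G$ is not a $k$-distance magic graph.
   Context: All graphs are finite, simple and undirected; $d(u,v)$ is the usual graph distance. For $u\in V(G)$ and $k\in\mathbb{N}$, $\partial N_k(u)=\{v\in V(G): d(u,v)=k\}$. For a graph $G$ of order $n\ge 3$, a $k$-distance magic labeling ($k$-DML) is a bijection $f:V(G)\to\{1,2,\dots,n\}$ such that $\sum_{w\in\partial N_k(u)} f(w)$ is a constant independent of $u\in V(G)$. $G$ is $k$-distance magic ($k$-DM) if it has a $k$-DML. -}

module Defs where

open import Data.Nat using (ℕ; zero; suc; _+_; _<_; _≤_)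
open import Data.Bool using (Bool; true; false; _∧_; _∨_; not; if_then_else_)
open import Data.Fin using (Fin; toℕ)
open import Data.Fin.Properties using (_≟_)
open import Data.List using (List; []; _∷_; allFin; upTo; map; filter; length)
open import Data.Nat.ListAction using (sum)
open import Data.Bool.ListAction using (any)
open import Relation.Nullary.Decidable using (⌊_⌋)
open import Relation.Binary.PropositionalEquality using (_≡_)
open import Function.Bundles using (_⤖_; Bijection)

record Graph (n : ℕ) : Set where
  field
    adj     : Fin n → Fin n → Bool
    symm    : ∀ u v → adj u v ≡ adj v u
    irrefl  : ∀ u → adj u u ≡ false

open Graph public

module _ {n : ℕ} (G : Graph n) where

  walk? : ℕ → Fin n → Fin n → Bool
  walk? zero    u v = ⌊ u ≟ v ⌋
  walk? (suc m) u v = any (λ w → adj G u w ∧ walk? m w v) (allFin n)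

  -- dist? u v k = true iff d(u,v) = k, i.e. k is the least length of a
  -- walk (equivalently a path) from u to v.
  dist? : Fin n → Fin n → ℕ → Bool
  dist? u v k = walk? k u v ∧ not (any (λ m → walk? m u v) (upTo k))

  sphere? : ℕ → Fin n → Fin n → Bool
  sphere? k u w = dist? u w k

  diffCard : ℕ → Fin n → Fin n → ℕ
  diffCard k u v = length (filter (λ w → sphere? k u w ∧ not (sphere? k v w) ≟ᵇ true) (allFin n))
    where
      open import Data.Bool.Properties renaming (_≟_ to _≟ᵇ_)

  sphereSum : ℕ → (Fin n → ℕ) → Fin n → ℕ
  sphereSum k ℓ u = sum (map (λ w → if sphere? k u w then ℓ w else 0) (allFin n))

  -- A labeling given by a bijection f : V(G) → Fin n; the label of w is
  -- toℕ (f w) + 1, so labels range bijectively over {1,…,n}.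
  label : (Fin n ⤖ Fin n) → Fin n → ℕ
  label f w = suc (toℕ (Bijection.to f w))

  IsKDML : ℕ → (Fin n ⤖ Fin n) → Set
  IsKDML k f = Σ' ℕ (λ c → ∀ u → sphereSum k (label f) u ≡ c)
    where
      open import Data.Product using () renaming (Σ to Σ')

open import Data.Product using (Σ; _×_)

IsKDM : {n : ℕ} → Graph n → ℕ → Set
IsKDM {n} G k = 3 ≤ n × Σ (Fin n ⤖ Fin n) (λ f → IsKDML G k f)

-- The sphere sums of u and v share the contribution of ∂N_k(u) ∩ ∂N_k(v),
-- so a magic constant forces the sums over the two one-element differences
-- {a} = ∂N_k(u) ∖ ∂N_k(v) and {b} = ∂N_k(v) ∖ ∂N_k(u) to agree: f(a) = f(b).
-- Labels are injective, so a = b, which cannot lie in both differences.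
module Submission where

open import Defs
open import Data.Nat using (ℕ; suc; _+_)
open import Data.Nat.Properties using (+-identityʳ; +-cancelˡ-≡; suc-injective; +-commutativeSemigroup)
open import Algebra.Properties.CommutativeSemigroup +-commutativeSemigroup using (interchange)
open import Data.Fin using (Fin)
open import Data.Fin.Properties using (toℕ-injective)
open import Data.Bool using (Bool; true; false; _∧_; not; if_then_else_)
open import Data.Bool.Properties using (∧-comm) renaming (_≟_ to _≟ᵇ_)
open import Data.List using (List; []; _∷_; map; filter; length; allFin)
open import Data.List.Membership.Propositional using (_∈_)
open import Data.List.Membership.Propositional.Properties using (∈-filter⁻)
open import Data.List.Relation.Unary.Any using (here)
open import Data.Nat.ListAction using (sum)
open import Data.Product using (Σ; _×_; _,_; proj₂)
open import Relation.Nullary using (¬_)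
open import Relation.Binary.PropositionalEquality using (_≡_; _≢_; refl; sym; trans; cong; cong₂; subst; module ≡-Reasoning)
open import Function.Bundles using (_⤖_; Bijection)
open import Function.Definitions using (Injective)

module _ {A : Set} where

  _∖_ : (A → Bool) → (A → Bool) → A → Bool
  (p ∖ q) w = p w ∧ not (q w)

  _∩_ : (A → Bool) → (A → Bool) → A → Bool
  (p ∩ q) w = p w ∧ q w

  -- Shaped so that sphereSum and diffCard unfold to sumIf and countIf definitionally.
  sumIf : (A → Bool) → (A → ℕ) → List A → ℕ
  sumIf p ℓ xs = sum (map (λ w → if p w then ℓ w else 0) xs)

  countIf : (A → Bool) → List A → ℕ
  countIf p xs = length (filter (λ w → p w ≟ᵇ true) xs)

  sum-map-cong : {f g : A → ℕ} → (∀ w → f w ≡ g w) → (xs : List A) →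
    sum (map f xs) ≡ sum (map g xs)
  sum-map-cong f≗g []       = refl
  sum-map-cong f≗g (x ∷ xs) = cong₂ _+_ (f≗g x) (sum-map-cong f≗g xs)

  sum-map-+ : (f g : A → ℕ) (xs : List A) →
    sum (map (λ w → f w + g w) xs) ≡ sum (map f xs) + sum (map g xs)
  sum-map-+ f g []       = refl
  sum-map-+ f g (x ∷ xs) = begin
    (f x + g x) + sum (map (λ w → f w + g w) xs)      ≡⟨ cong ((f x + g x) +_) (sum-map-+ f g xs) ⟩
    (f x + g x) + (sum (map f xs) + sum (map g xs))   ≡⟨ interchange (f x) (g x) _ _ ⟩
    (f x + sum (map f xs)) + (g x + sum (map g xs))   ∎
    where open ≡-Reasoning

  sumIf-filter : (p : A → Bool) (ℓ : A → ℕ) (xs : List A) →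
    sumIf p ℓ xs ≡ sum (map ℓ (filter (λ w → p w ≟ᵇ true) xs))
  sumIf-filter p ℓ []       = refl
  sumIf-filter p ℓ (x ∷ xs) with p x
  ... | true  = cong (ℓ x +_) (sumIf-filter p ℓ xs)
  ... | false = sumIf-filter p ℓ xs

  sumIf-cong : {p q : A → Bool} → (∀ w → p w ≡ q w) → (ℓ : A → ℕ) (xs : List A) →
    sumIf p ℓ xs ≡ sumIf q ℓ xs
  sumIf-cong p≗q ℓ = sum-map-cong (λ w → cong (λ b → if b then ℓ w else 0) (p≗q w))

  sumIf-split : (p q : A → Bool) (ℓ : A → ℕ) (xs : List A) →
    sumIf p ℓ xs ≡ sumIf (p ∩ q) ℓ xs + sumIf (p ∖ q) ℓ xs
  sumIf-split p q ℓ xs = trans (sum-map-cong (λ w → if-split (p w) (q w) (ℓ w)) xs)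
                               (sum-map-+ _ _ xs)
    where
    if-split : (b c : Bool) (l : ℕ) →
      (if b then l else 0) ≡ (if b ∧ c then l else 0) + (if b ∧ not c then l else 0)
    if-split true  true  l = sym (+-identityʳ l)
    if-split true  false l = refl
    if-split false c     l = refl

  sumIf-≡⇒sumIf-∖-≡ : (p q : A → Bool) (ℓ : A → ℕ) (xs : List A) →
    sumIf p ℓ xs ≡ sumIf q ℓ xs → sumIf (p ∖ q) ℓ xs ≡ sumIf (q ∖ p) ℓ xs
  sumIf-≡⇒sumIf-∖-≡ p q ℓ xs eq = +-cancelˡ-≡ (sumIf (p ∩ q) ℓ xs) _ _ (begin
    sumIf (p ∩ q) ℓ xs + sumIf (p ∖ q) ℓ xs   ≡⟨ sym (sumIf-split p q ℓ xs) ⟩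
    sumIf p ℓ xs                              ≡⟨ eq ⟩
    sumIf q ℓ xs                              ≡⟨ sumIf-split q p ℓ xs ⟩
    sumIf (q ∩ p) ℓ xs + sumIf (q ∖ p) ℓ xs   ≡⟨ cong (_+ sumIf (q ∖ p) ℓ xs) (sumIf-cong (λ w → ∧-comm (q w) (p w)) ℓ xs) ⟩
    sumIf (p ∩ q) ℓ xs + sumIf (q ∖ p) ℓ xs   ∎)
    where open ≡-Reasoning

  countIf≡1⇒sumIf-singleton : (p : A → Bool) (ℓ : A → ℕ) (xs : List A) → countIf p xs ≡ 1 →
    Σ A (λ a → p a ≡ true × sumIf p ℓ xs ≡ ℓ a)
  countIf≡1⇒sumIf-singleton p ℓ xs count≡1
    with filter (λ w → p w ≟ᵇ true) xs in filter≡ | sumIf-filter p ℓ xs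
  countIf≡1⇒sumIf-singleton p ℓ xs refl | a ∷ [] | sum≡ =
    a , pa , trans sum≡ (+-identityʳ (ℓ a))
    where
    pa : p a ≡ true
    pa = proj₂ (∈-filter⁻ (λ w → p w ≟ᵇ true) {xs = xs} (subst (a ∈_) (sym filter≡) (here refl)))

  ∖-asymmetric : (p q : A → Bool) (w : A) → (p ∖ q) w ≡ true → ¬ (q ∖ p) w ≡ true
  ∖-asymmetric p q w _ with p w | q w
  ∖-asymmetric p q w () | false | _
  ∖-asymmetric p q w () | true  | true
  ∖-asymmetric p q w _  | true  | false = λ ()

  sumIf-≢-of-singleton-differences : (p q : A → Bool) {ℓ : A → ℕ} → Injective _≡_ _≡_ ℓ →
    (xs : List A) → countIf (p ∖ q) xs ≡ 1 → countIf (q ∖ p) xs ≡ 1 →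
    sumIf p ℓ xs ≢ sumIf q ℓ xs
  sumIf-≢-of-singleton-differences p q {ℓ} ℓ-injective xs p∖q≡1 q∖p≡1 sums≡
    with countIf≡1⇒sumIf-singleton (p ∖ q) ℓ xs p∖q≡1
       | countIf≡1⇒sumIf-singleton (q ∖ p) ℓ xs q∖p≡1
  ... | a , a∈p∖q , sum-p∖q≡ℓa | b , b∈q∖p , sum-q∖p≡ℓb =
    ∖-asymmetric p q a a∈p∖q (subst (λ w → (q ∖ p) w ≡ true) b≡a b∈q∖p)
    where
    b≡a : b ≡ a
    b≡a = ℓ-injective (begin
      ℓ b                 ≡⟨ sum-q∖p≡ℓb ⟨
      sumIf (q ∖ p) ℓ xs  ≡⟨ sumIf-≡⇒sumIf-∖-≡ p q ℓ xs sums≡ ⟨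
      sumIf (p ∖ q) ℓ xs  ≡⟨ sum-p∖q≡ℓa ⟩
      ℓ a                 ∎)
      where open ≡-Reasoning

label-injective : {n : ℕ} (G : Graph n) (f : Fin n ⤖ Fin n) → Injective _≡_ _≡_ (label G f)
label-injective G f eq = Bijection.injective f (toℕ-injective (suc-injective eq))

lemma1p4 : (n k : ℕ) (G : Graph n) (u v : Fin n) →
    diffCard G k u v ≡ 1 → diffCard G k v u ≡ 1 → ¬ IsKDM G k
lemma1p4 n k G u v u∖v≡1 v∖u≡1 (_ , f , _ , magic) =
  sumIf-≢-of-singleton-differences (sphere? G k u) (sphere? G k v) (label-injective G f)
    (allFin n) u∖v≡1 v∖u≡1 (trans (magic u) (sym (magic v)))
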